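{- Let $\beta\ge3$ be an integer, let $(G=(A,B,E),\{A_i\},\{B_i\})$ be a Min-Rep instance and let $G'$ be the directed graph constructed from it as described in the context. If there is a REP-cover of the Min-Rep instance of size $\gamma$, then there is a shortcut set for $G'$ with hopbound $\beta$ and size $\gamma$.
   Context: Min-Rep instance: an undirected bipartite graph $G=(A,B,E)$ with partitions $A=A_1\cup\dots\cup A_m$ and $B=B_1\cup\dots\cup B_m$ into groups, all of the same size. $(i,j)$ is a superedge if some edge joins $A_i$ and $B_j$. A REP-cover is a set $S\subseteq A\cup B$ such that for every superedge $(i,j)$ there are $x\in A_i\cap S$, $y\in B_j\cap S$ with $\{x,y\}\in E$. Construction of $G'=(V',E')$: add new vertices $a_i^1,a_i^2,b_i^1,b_i^2$ for $i\in[m]$, and for each $e=\{a,b\}\in E$ ($a\in A$, $b\in B$) new vertices $v_e^1,\dots,v_e^{\beta-3}$ (none if $\beta=3$); $V'$ is $A\cup B$ together with all these. Directed edges: for each $e=\{a,b\}$ the path $P_e$ consisting of $(a,v_e^1)$, $(v_e^i,v_e^{i+1})$ for $i\in[\beta-4]$, and $(v_e^{\beta-3},b)$ (if $\beta=3$, $P_e=\{(a,b)\}$); plus $(a_i^1,a_i^2)$ and $(b_i^2,b_i^1)$ for $i\in[m]$; plus $(a_i^2,x)$ for $x\in A_i$ and $(x,b_i^2)$ for $x\in B_i$. A shortcut set with hopbound $\beta$ for $G'$ is a set $S'$ of directed edges $(x,y)$ with $y$ reachable from $x$ in $G'$ such that for every pair $x,y$ with $y$ reachable from $x$, $G'\cup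 S'$ has an $x$–$y$ path with at most $\beta$ edges. -}

module Defs where

open import Data.Nat using (ℕ; zero; suc; _∸_; _≤_)
open import Data.Fin using (Fin; toℕ)
open import Data.Bool using (Bool; T)
open import Data.Product using (_×_; _,_; ∃-syntax)
open import Data.Sum using (_⊎_)
open import Data.List using (List; length)
open import Data.List.Membership.Propositional using (_∈_)
open import Data.List.Relation.Unary.Unique.Propositional using (Unique)
open import Relation.Binary.PropositionalEquality using (_≡_)
open import Relation.Binary.Construct.Closure.ReflexiveTransitive using (Star)

-- Paths of at most n edges in a directed graph with edge relation R.
data Within {V : Set} (R : V → V → Set) : ℕ → V → V → Set where
  here : ∀ {n x} → Within R n x x
  step : ∀ {n x y z} → R x y → Within R n y z → Within R (suc n) x z

-- A Min-Rep instance with m groups on each side, each group of size k.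
-- Vertex x ∈ A_i is (i , x) with x : Fin k; similarly for B_j.
-- The edge set is given by E i x j y = true iff {(i,x) ∈ A, (j,y) ∈ B} ∈ E.
module MinRep (m k : ℕ) (E : Fin m → Fin k → Fin m → Fin k → Bool) where

  data AB : Set where
    aV : Fin m → Fin k → AB
    bV : Fin m → Fin k → AB

  Superedge : Fin m → Fin m → Set
  Superedge i j = ∃[ x ] ∃[ y ] T (E i x j y)

  IsREPCover : List AB → Set
  IsREPCover S = ∀ i j → Superedge i j →
    ∃[ x ] ∃[ y ] (aV i x ∈ S × bV j y ∈ S × T (E i x j y))

  -- REP-cover of size γ (a set, i.e. a duplicate-free list, with γ elements)
  REPCoverOfSize : ℕ → Set
  REPCoverOfSize γ = ∃[ S ] (Unique S × length S ≡ γ × IsREPCover S)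

  module Construction (β : ℕ) where

    data V' : Set where
      inA : Fin m → Fin k → V'
      inB : Fin m → Fin k → V'
      a¹ a² b¹ b² : Fin m → V'
      -- v_e^{t+1} for e = {(i,x),(j,y)} ∈ E and t : Fin (β ∸ 3)
      pv : (i : Fin m) (x : Fin k) (j : Fin m) (y : Fin k) → T (E i x j y) →
           Fin (β ∸ 3) → V'

    data Edge' : V' → V' → Set where
      direct : ∀ {i x j y} → T (E i x j y) → β ≡ 3 → Edge' (inA i x) (inB j y)
      first  : ∀ {i x j y} (e : T (E i x j y)) (t : Fin (β ∸ 3)) → toℕ t ≡ 0 →
               Edge' (inA i x) (pv i x j y e t)
      next   : ∀ {i x j y} (e : T (E i x j y)) (t t' : Fin (β ∸ 3)) →
               toℕ t' ≡ suc (toℕ t) → Edge' (pv i x j y e t) (pv i x j y e t')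
      last   : ∀ {i x j y} (e : T (E i x j y)) (t : Fin (β ∸ 3)) →
               suc (toℕ t) ≡ β ∸ 3 → Edge' (pv i x j y e t) (inB j y)
      a¹a² : ∀ i → Edge' (a¹ i) (a² i)
      b²b¹ : ∀ i → Edge' (b² i) (b¹ i)
      a²x  : ∀ i x → Edge' (a² i) (inA i x)
      xb²  : ∀ i x → Edge' (inB i x) (b² i)

    Reachable : V' → V' → Set
    Reachable = Star Edge'

    WithShortcuts : List (V' × V') → V' → V' → Set
    WithShortcuts S' u v = Edge' u v ⊎ (u , v) ∈ S'

    IsShortcutSet : List (V' × V') → Set
    IsShortcutSet S' =
      (∀ {u v} → (u , v) ∈ S' → Reachable u v) ×
      (∀ u v → Reachable u v → Within (WithShortcuts S') β u v)

    ShortcutSetOfSize : ℕ → Set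
    ShortcutSetOfSize γ = ∃[ S' ] (Unique S' × length S' ≡ γ × IsShortcutSet S')

-- G' is layered: giving a¹ᵢ, a²ᵢ, Aᵢ, v_e^t, Bⱼ, b²ⱼ, b¹ⱼ the levels 0, 1, 2, 2 + t, β, β + 1,
-- β + 2, every edge goes up exactly one level, so every path has length equal to the level gap.
-- Hence only the pairs (a¹ᵢ, b²ⱼ), (a¹ᵢ, b¹ⱼ), (a²ᵢ, b¹ⱼ) need help, and they are reachable only
-- when (i, j) is a superedge.  A REP-cover S gives the shortcut (a¹ᵢ, x) for each x ∈ S ∩ Aᵢ and
-- (y, b¹ⱼ) for each y ∈ S ∩ Bⱼ; for a covering edge e = {x, y} the route a¹ᵢ → x, then P_e,
-- then y → b¹ⱼ has 1 + (β − 2) + 1 = β hops, and likewise in the two other cases.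
module Submission where

open import Defs
open import Data.Nat using (ℕ; zero; suc; _+_; _≤_; _<_; z≤n; s≤s)
open import Data.Nat.Properties
open import Data.Fin using (Fin; toℕ; fromℕ<) renaming (zero to fzero)
open import Data.Fin.Properties using (toℕ-fromℕ<; toℕ<n)
open import Data.Bool using (Bool; T)
open import Data.Product using (_×_; _,_; ∃-syntax)
open import Data.Sum using (inj₁; inj₂)
open import Data.List using (List; map)
open import Data.List.Properties using (length-map)
open import Data.List.Membership.Propositional using (_∈_)
open import Data.List.Membership.Propositional.Properties using (∈-map⁺; ∈-map⁻)
open import Data.List.Relation.Unary.Unique.Propositional.Properties as Unique using ()
open import Relation.Binary.PropositionalEquality
open import Relation.Binary.Construct.Closure.ReflexiveTransitive using (Star; ε; _◅_)

module _ {V : Set} {R : V → V → Set} where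

  Within-map : {R′ : V → V → Set} → (∀ {x y} → R x y → R′ x y) →
               ∀ {h x y} → Within R h x y → Within R′ h x y
  Within-map f here       = here
  Within-map f (step r w) = step (f r) (Within-map f w)

  Within-weaken : ∀ {h h′ x y} → Within R h x y → h ≤ h′ → Within R h′ x y
  Within-weaken here       _         = here
  Within-weaken (step r w) (s≤s h≤) = step r (Within-weaken w h≤)

  Within-++ : ∀ {h h′ x y z} → Within R h x y → Within R h′ y z → Within R (h + h′) x z
  Within-++ here       w′ = Within-weaken w′ (m≤n+m _ _)
  Within-++ (step r w) w′ = step r (Within-++ w w′)

  module Layered (level : V → ℕ) (level-step : ∀ {u v} → R u v → level v ≡ suc (level u)) where

    Star⇒Within-gap : ∀ {u v} → Star R u v → ∃[ h ] (Within R h u v × level v ≡ h + level u)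
    Star⇒Within-gap ε = 0 , here , refl
    Star⇒Within-gap {u} (r ◅ p) with Star⇒Within-gap p
    ... | h , w , gap = suc h , step r w , trans gap (trans (cong (h +_) (level-step r)) (+-suc h (level u)))

    Star⇒Within : ∀ {h u v} → Star R u v → level v ≤ h + level u → Within R h u v
    Star⇒Within {h} {u} p bound with Star⇒Within-gap p
    ... | h′ , w , gap = Within-weaken w (+-cancelʳ-≤ (level u) h′ h (subst (_≤ h + level u) gap bound))

module _ (m k : ℕ) (E : Fin m → Fin k → Fin m → Fin k → Bool) where
  open MinRep m k E

  -- The construction is only ever used with β = 3 + n, so that β ∸ 3 reduces to n.
  P-star : ∀ n {i x j y} (e : T (E i x j y)) →
           Star (Construction.Edge' (3 + n)) (Construction.inA i x) (Construction.inB j y)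
  P-star zero    e = Construction.direct e refl ◅ ε
  P-star (suc n) {i} {x} {j} {y} e = first e fzero refl ◅ P-from n fzero refl
    where
    open Construction (3 + suc n)

    P-from : ∀ r (t : Fin (suc n)) → toℕ t + r ≡ n → Star Edge' (pv i x j y e t) (inB j y)
    P-from zero    t t+0≡n = last e t (cong suc (trans (sym (+-identityʳ (toℕ t))) t+0≡n)) ◅ ε
    P-from (suc r) t t+r≡n = next e t t′ (toℕ-fromℕ< t+1<) ◅ P-from r t′ t′+r≡n
      where
      t+r+1≡n : suc (toℕ t + r) ≡ n
      t+r+1≡n = trans (sym (+-suc (toℕ t) r)) t+r≡n
      t+1< : suc (toℕ t) < suc n
      t+1< = s≤s (≤-trans (m≤m+n (suc (toℕ t)) r) (≤-reflexive t+r+1≡n))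
      t′ : Fin (suc n)
      t′ = fromℕ< t+1<
      t′+r≡n : toℕ t′ + r ≡ n
      t′+r≡n = trans (cong (_+ r) (toℕ-fromℕ< t+1<)) t+r+1≡n

  module ShortcutsFromCover (n : ℕ) where
    open Construction (3 + n)

    shortcut : AB → V' × V'
    shortcut (aV i x) = a¹ i , inA i x
    shortcut (bV j y) = inB j y , b¹ j

    shortcut-injective : ∀ {a b} → shortcut a ≡ shortcut b → a ≡ b
    shortcut-injective {aV _ _} {aV _ _} refl = refl
    shortcut-injective {bV _ _} {bV _ _} refl = refl

    shortcut-reachable : ∀ S {u v} → (u , v) ∈ map shortcut S → Reachable u v
    shortcut-reachable S u,v∈ with ∈-map⁻ shortcut u,v∈
    ... | aV i x , _ , refl = a¹a² i ◅ a²x i x ◅ ε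
    ... | bV j y , _ , refl = xb² j y ◅ b²b¹ j ◅ ε

    level : V' → ℕ
    level (inA _ _)          = 2
    level (inB _ _)          = 3 + n
    level (a¹ _)             = 0
    level (a² _)             = 1
    level (b¹ _)             = 5 + n
    level (b² _)             = 4 + n
    level (pv _ _ _ _ _ t)   = 3 + toℕ t

    level-step : ∀ {u v} → Edge' u v → level v ≡ suc (level u)
    level-step (direct _ 3+n≡3)  = 3+n≡3
    level-step (first _ _ t≡0)   = cong (3 +_) t≡0
    level-step (next _ _ _ t′≡)  = cong (3 +_) t′≡
    level-step (last _ _ t+1≡n)  = cong (3 +_) (sym t+1≡n)
    level-step (a¹a² _)          = refl
    level-step (b²b¹ _)          = refl
    level-step (a²x _ _)         = refl
    level-step (xb² _ _)         = refl

    open Layered {R = Edge'} level level-step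

    level-pv≤β : ∀ (t : Fin n) → 3 + toℕ t ≤ 3 + n
    level-pv≤β t = +-monoʳ-≤ 3 (<⇒≤ (toℕ<n t))

    level≤β+2 : ∀ v → level v ≤ 5 + n
    level≤β+2 (inA _ _)        = s≤s (s≤s z≤n)
    level≤β+2 (inB _ _)        = m≤n+m _ 2
    level≤β+2 (a¹ _)           = z≤n
    level≤β+2 (a² _)           = s≤s z≤n
    level≤β+2 (b¹ _)           = ≤-refl
    level≤β+2 (b² _)           = n≤1+n _
    level≤β+2 (pv _ _ _ _ _ t) = ≤-trans (level-pv≤β t) (m≤n+m _ 2)

    -- Over-approximates the vertices reachable from a¹ᵢ; on the B side it records the superedge.
    Downstream : Fin m → V' → Set
    Downstream i (inA i′ _)          = i′ ≡ i
    Downstream i (inB j _)           = Superedge i j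
    Downstream i (a¹ i′)             = i′ ≡ i
    Downstream i (a² i′)             = i′ ≡ i
    Downstream i (b¹ j)              = Superedge i j
    Downstream i (b² j)              = Superedge i j
    Downstream i (pv i′ _ _ _ _ _)   = i′ ≡ i

    Downstream-step : ∀ {i u v} → Edge' u v → Downstream i u → Downstream i v
    Downstream-step (direct {x = x} {y = y} e _) refl = x , y , e
    Downstream-step (last {x = x} {y = y} e _ _) refl = x , y , e
    Downstream-step (first _ _ _)                d    = d
    Downstream-step (next _ _ _ _)               d    = d
    Downstream-step (a¹a² _)                     d    = d
    Downstream-step (b²b¹ _)                     d    = d
    Downstream-step (a²x _ _)                    d    = d
    Downstream-step (xb² _ _)                    d    = d

    Downstream-star : ∀ {i u v} → Reachable u v → Downstream i u → Downstream i v
    Downstream-star ε       d = d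
    Downstream-star (r ◅ p) d = Downstream-star p (Downstream-step r d)

    module _ (S : List AB) where
      Hop : V' → V' → Set
      Hop = WithShortcuts (map shortcut S)

      Reachable⇒Hops : ∀ {h u v} → Reachable u v → level v ≤ h + level u → Within Hop h u v
      Reachable⇒Hops p bound = Within-map inj₁ (Star⇒Within p bound)

      hops-to-level≤β : ∀ {u v} → Reachable u v → level v ≤ 3 + n → Within Hop (3 + n) u v
      hops-to-level≤β p bound = Reachable⇒Hops p (≤-trans bound (m≤m+n _ _))

      hops-from-level≥2 : ∀ {u v} → Reachable u v → 2 ≤ level u → Within Hop (3 + n) u v
      hops-from-level≥2 {v = v} p bound =
        Reachable⇒Hops p (≤-trans (level≤β+2 v) (≤-trans (≤-reflexive (cong (3 +_) (+-comm 2 n))) (+-monoʳ-≤ (3 + n) bound)))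

      across-cover-edge : ∀ {u v i x j y} → T (E i x j y) → Hop u (inA i x) → Hop (inB j y) v →
                          Within Hop (3 + n) u v
      across-cover-edge {i = i} {x} {j} {y} e enter leave =
        Within-weaken (step enter (Within-++ P-hops (step leave here)))
                      (≤-reflexive (cong (2 +_) (+-comm n 1)))
        where
        P-hops : Within Hop (1 + n) (inA i x) (inB j y)
        P-hops = Reachable⇒Hops {h = 1 + n} (P-star n e) (≤-reflexive (cong suc (+-comm 2 n)))

      module _ (cover : IsREPCover S) where

        via-cover : ∀ {u v} i j → Superedge i j →
                    (∀ {x} → aV i x ∈ S → Hop u (inA i x)) →
                    (∀ {y} → bV j y ∈ S → Hop (inB j y) v) → Within Hop (3 + n) u v
        via-cover i j ij enter leave with cover i j ij
        ... | x , y , x∈S , y∈S , e = across-cover-edge e (enter x∈S) (leave y∈S)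

        a¹-shortcut : ∀ {i x} → aV i x ∈ S → Hop (a¹ i) (inA i x)
        a¹-shortcut x∈S = inj₂ (∈-map⁺ shortcut x∈S)

        b¹-shortcut : ∀ {j y} → bV j y ∈ S → Hop (inB j y) (b¹ j)
        b¹-shortcut y∈S = inj₂ (∈-map⁺ shortcut y∈S)

        hops : ∀ u v → Reachable u v → Within Hop (3 + n) u v
        hops (a¹ i) (b² j) p = via-cover i j (Downstream-star p refl) a¹-shortcut (λ {y} _ → inj₁ (xb² j y))
        hops (a¹ i) (b¹ j) p = via-cover i j (Downstream-star p refl) a¹-shortcut b¹-shortcut
        hops (a² i) (b¹ j) p = via-cover i j (Downstream-star p refl) (λ {x} _ → inj₁ (a²x i x)) b¹-shortcut
        hops (a² i) (b² j) p = Reachable⇒Hops p (≤-reflexive (cong (3 +_) (+-comm 1 n)))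
        hops (a¹ _) (inA _ _)          p = hops-to-level≤β p (s≤s (s≤s z≤n))
        hops (a¹ _) (inB _ _)          p = hops-to-level≤β p ≤-refl
        hops (a¹ _) (a¹ _)             p = hops-to-level≤β p z≤n
        hops (a¹ _) (a² _)             p = hops-to-level≤β p (s≤s z≤n)
        hops (a¹ _) (pv _ _ _ _ _ t)   p = hops-to-level≤β p (level-pv≤β t)
        hops (a² _) (inA _ _)          p = hops-to-level≤β p (s≤s (s≤s z≤n))
        hops (a² _) (inB _ _)          p = hops-to-level≤β p ≤-refl
        hops (a² _) (a¹ _)             p = hops-to-level≤β p z≤n
        hops (a² _) (a² _)             p = hops-to-level≤β p (s≤s z≤n)
        hops (a² _) (pv _ _ _ _ _ t)   p = hops-to-level≤β p (level-pv≤β t)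
        hops (inA _ _)        _ p = hops-from-level≥2 p ≤-refl
        hops (inB _ _)        _ p = hops-from-level≥2 p (s≤s (s≤s z≤n))
        hops (b¹ _)           _ p = hops-from-level≥2 p (s≤s (s≤s z≤n))
        hops (b² _)           _ p = hops-from-level≥2 p (s≤s (s≤s z≤n))
        hops (pv _ _ _ _ _ _) _ p = hops-from-level≥2 p (s≤s (s≤s z≤n))

lemma50 : (β : ℕ) → 3 ≤ β → (m k : ℕ) (E : Fin m → Fin k → Fin m → Fin k → Bool) (γ : ℕ) →
    MinRep.REPCoverOfSize m k E γ → MinRep.Construction.ShortcutSetOfSize m k E β γ
lemma50 _ (s≤s (s≤s (s≤s {n = n} z≤n))) m k E γ (S , S-unique , S-size , S-cover) =
  map shortcut S ,
  Unique.map⁺ shortcut-injective S-unique ,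
  trans (length-map shortcut S) S-size ,
  shortcut-reachable S ,
  hops S S-cover
  where open ShortcutsFromCover m k E n
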